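{- Let $T$ and $T'$ be two signed trees on the same vertex set $V$ (each with its own partition of $V$ into negative and positive vertices) such that $\mathcal{B}(T)=\mathcal{B}(T')$. Then $T$ and $T'$ have the same edges, and every vertex that is not a leaf has the same sign in $T$ and in $T'$. (That is, $T$ can be reconstructed from $\mathcal{B}(T)$ except for the signs of its leaves.)
   Context: A signed tree is a tree $T$ with vertex set $V$ partitioned into negative and positive vertices $V=V^-\sqcup V^+$. $B\subseteq V$ is negative (resp. positive) convex in $T$ if every negative (resp. positive) vertex on the path in $T$ between two vertices of $B$ lies in $B$. A signed building block of $T$ is a $B\subseteq V$ which is negative convex and whose complement $V\setminus B$ is positive convex; $\mathcal{B}(T)$ is the set of signed building blocks. -}

module Defs where

open import Data.Nat using (ℕ; _≤_; _≥_)
open import Data.Fin using (Fin)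
open import Data.Bool using (Bool; true; false)
open import Data.List using (List; []; _∷_; length; filter; allFin)
open import Data.List.Membership.Propositional using () renaming (_∈_ to _∈ₗ_)
open import Data.List.Relation.Unary.Unique.Propositional using (Unique)
open import Data.Fin.Subset using (Subset; _∈_; _∉_; ∁)
open import Data.Product using (Σ; ∃; ∃-syntax; _×_)
open import Data.Empty using (⊥)
open import Relation.Binary.PropositionalEquality using (_≡_; _≢_)
open import Relation.Nullary using (¬_)
open import Data.Bool.Properties using (T?)
open import Data.Bool using (T)

data Sign : Set where
  neg pos : Sign

data Walk {n : ℕ} (adj : Fin n → Fin n → Bool) : Fin n → Fin n → List (Fin n) → Set where
  here : ∀ {u} → Walk adj u u (u ∷ [])
  step : ∀ {u w v p} → adj u w ≡ true → Walk adj w v p → Walk adj u v (u ∷ p)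

IsPath : {n : ℕ} → (Fin n → Fin n → Bool) → Fin n → Fin n → List (Fin n) → Set
IsPath adj u v p = Walk adj u v p × Unique p

record SignedTree (n : ℕ) : Set where
  field
    adj       : Fin n → Fin n → Bool
    symmetric : ∀ u v → adj u v ≡ adj v u
    loopless  : ∀ u → adj u u ≡ false
    connected : ∀ u v → ∃[ p ] Walk adj u v p
    acyclic   : ∀ u w p → IsPath adj w u p → 3 ≤ length p → adj u w ≢ true
    sign      : Fin n → Sign

open SignedTree public

degree : {n : ℕ} → SignedTree n → Fin n → ℕ
degree t v = length (filter (λ w → T? (adj t v w)) (allFin _))

IsLeaf : {n : ℕ} → SignedTree n → Fin n → Set
IsLeaf t v = degree t v ≤ 1

-- B is s-convex in t: every s-vertex on the path in t between two vertices of B lies in B.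
-- (Paths in a tree are unique, so quantifying over all simple paths is the same.)
Convex : {n : ℕ} → Sign → SignedTree n → Subset n → Set
Convex s t B = ∀ u v p → u ∈ B → v ∈ B → IsPath (adj t) u v p →
               ∀ w → w ∈ₗ p → sign t w ≡ s → w ∈ B

NegConvex PosConvex : {n : ℕ} → SignedTree n → Subset n → Set
NegConvex = Convex neg
PosConvex = Convex pos

IsBuildingBlock : {n : ℕ} → SignedTree n → Subset n → Set
IsBuildingBlock t B = NegConvex t B × PosConvex t (∁ B)

-- Removing an edge ab of a tree splits it into the side of a and the side
-- of b; every side is convex for paths of the tree, hence a signed building
-- block together with its complement. If uv is an edge of T but not of T′,
-- the T′-path from u to v passes through some w ∉ {u, v}; cutting T at the
-- first edge on the T-path from w towards u puts u and v on one side and w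
-- on the other, so that side and its complement cannot both be building
-- blocks of T′. For the signs, a negative vertex v of T makes ⁅ v ⁆ a
-- building block of T, and a positive one makes ∁ ⁅ v ⁆ one; if v has two
-- neighbours, the path through them shows that this fails in T′ as soon as
-- the sign of v in T′ differs.
module Submission where

open import Defs
open import Data.Nat using (ℕ; s≤s; z≤n; _≤_)
open import Data.Fin using (Fin; _≟_)
open import Data.Fin.Subset using (Subset; _∈_; _∉_; ∁; ⁅_⁆)
open import Data.Fin.Subset.Properties
  using (_∈?_; x∈∁p⇒x∉p; x∉p⇒x∈∁p; x∉∁p⇒x∈p; x∈⁅x⁆; x∈⁅y⁆⇒x≡y; x≢y⇒x∉⁅y⁆)
open import Data.Product using (_×_; _,_; proj₁; proj₂; ∃-syntax; ∃₂)
open import Data.Bool using (Bool; true)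
open import Data.Bool.Properties using (T?; T-≡; not-involutive; ⇔→≡)
open import Data.Vec using ([]; _∷_; tabulate)
open import Data.Vec.Properties using (lookup∘tabulate; []=⇒lookup; lookup⇒[]=)
open import Data.List using (List; []; _∷_; _++_; length; filter; allFin)
open import Data.List.Relation.Unary.Any using (here; there)
open import Data.List.Relation.Unary.All as All using (All)
open import Data.List.Relation.Unary.All.Properties using (¬Any⇒All¬; All¬⇒¬Any)
open import Data.List.Relation.Unary.AllPairs using ([]; _∷_)
open import Data.List.Relation.Unary.Unique.Propositional using (Unique)
open import Data.List.Relation.Unary.Unique.Propositional.Properties using (filter⁺; allFin⁺)
open import Data.List.Membership.Propositional using () renaming (_∈_ to _∈ₗ_; _∉_ to _∉ₗ_)
open import Data.List.Membership.Propositional.Properties using (∈-++⁻; ∈-filter⁻)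
open import Data.List.Relation.Binary.Subset.Propositional using (_⊆_)
open import Data.List.Relation.Binary.Subset.Propositional.Properties
  using (⊆-refl; ∷⁺ʳ)
open import Data.Sum using (inj₁; inj₂)
open import Data.Empty using (⊥-elim)
open import Relation.Binary.PropositionalEquality using (_≡_; _≢_; refl; sym; trans; cong₂; subst; ≢-sym)
open import Relation.Nullary using (¬_; Dec; yes; no; does; proof)
open import Relation.Nullary.Reflects using (Reflects; invert)
open import Relation.Nullary.Decidable using (dec-true)
open import Function using (_∘_)
open import Function.Bundles using (_⇔_; Equivalence; mk⇔)
import Function.Properties.Equivalence as ⇔

open Equivalence using (to; from)

neg≢pos : neg ≢ pos
neg≢pos ()

two-distinct : ∀ {a} {A : Set a} {xs : List A} → Unique xs → ¬ length xs ≤ 1 →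
               ∃₂ λ x y → x ∈ₗ xs × y ∈ₗ xs × x ≢ y
two-distinct {xs = []}        _                   ¬≤1 = ⊥-elim (¬≤1 z≤n)
two-distinct {xs = _ ∷ []}    _                   ¬≤1 = ⊥-elim (¬≤1 (s≤s z≤n))
two-distinct {xs = x ∷ y ∷ _} ((x≢y All.∷ _) ∷ _) _   = x , y , here refl , there (here refl) , x≢y

∁-involutive : ∀ {n} (B : Subset n) → ∁ (∁ B) ≡ B
∁-involutive []      = refl
∁-involutive (b ∷ B) = cong₂ _∷_ (not-involutive b) (∁-involutive B)

decSubset : ∀ {n} {P : Fin n → Set} → (∀ x → Dec (P x)) → Subset n
decSubset P? = tabulate (does ∘ P?)

∈-decSubset : ∀ {n} {P : Fin n → Set} (P? : ∀ x → Dec (P x)) {x} → x ∈ decSubset P? ⇔ P x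
∈-decSubset P? {x} = mk⇔
  (λ x∈ → invert (subst (Reflects _) (trans (sym (lookup∘tabulate (does ∘ P?) x)) ([]=⇒lookup x∈))
                                     (proof (P? x))))
  (λ Px → lookup⇒[]= x _ (trans (lookup∘tabulate (does ∘ P?) x) (dec-true (P? x) Px)))

walk-resp-adj : ∀ {n} {adj adj′ : Fin n → Fin n → Bool} → (∀ u v → adj u v ≡ adj′ u v) →
                ∀ {u v p} → Walk adj u v p → Walk adj′ u v p
walk-resp-adj adj≡ here                = here
walk-resp-adj adj≡ (step {u} {w} uw r) = step (trans (sym (adj≡ u w)) uw) (walk-resp-adj adj≡ r)

module Graph {n : ℕ} (adj : Fin n → Fin n → Bool) (adj-sym : ∀ u v → adj u v ≡ adj v u) where

  open import Data.List.Membership.DecPropositional (_≟_ {n}) using () renaming (_∈?_ to _∈ₗ?_)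

  ∈-head : ∀ {u v p} → Walk adj u v p → u ∈ₗ p
  ∈-head here       = here refl
  ∈-head (step _ _) = here refl

  ∈-last : ∀ {u v p} → Walk adj u v p → v ∈ₗ p
  ∈-last here       = here refl
  ∈-last (step _ r) = there (∈-last r)

  1≤length : ∀ {u v p} → Walk adj u v p → 1 ≤ length p
  1≤length here       = s≤s z≤n
  1≤length (step _ _) = s≤s z≤n

  join : ∀ {u v w z p q} → Walk adj u v p → adj v w ≡ true → Walk adj w z q → Walk adj u z (p ++ q)
  join here        vw r = step vw r
  join (step e r′) vw r = step e (join r′ vw r)

  reverse : ∀ {u v p} → Walk adj u v p → ∃[ q ] Walk adj v u q × q ⊆ p
  reverse here = _ , here , ⊆-refl
  reverse {u} (step {w = w} uw r) with reverse r
  ... | q , wq , q⊆ = q ++ u ∷ [] , join wq (trans (adj-sym w u) uw) here , ⊆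
    where
    ⊆ : q ++ u ∷ [] ⊆ u ∷ _
    ⊆ x∈ with ∈-++⁻ q x∈
    ... | inj₁ x∈q        = there (q⊆ x∈q)
    ... | inj₂ (here x≡u) = here x≡u

  suffixFrom : ∀ {u w v q} → IsPath adj w v q → u ∈ₗ q → ∃[ r ] IsPath adj u v r × r ⊆ q
  suffixFrom π@(here , _)            (here refl) = _ , π , ⊆-refl
  suffixFrom π@(step _ _ , _)        (here refl) = _ , π , ⊆-refl
  suffixFrom (here , _)              (there ())
  suffixFrom (step _ r , _ ∷ uq)     (there u∈)  with suffixFrom (r , uq) u∈
  ... | s , σ , s⊆ = s , σ , there ∘ s⊆

  toPath : ∀ {u v p} → Walk adj u v p → ∃[ q ] IsPath adj u v q × q ⊆ p
  toPath here = _ , (here , All.[] ∷ []) , ⊆-refl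
  toPath {u} (step uw r) with toPath r
  ... | q , (wq , uq) , q⊆ with u ∈ₗ? q
  ...   | yes u∈q = let s , σ , s⊆ = suffixFrom (wq , uq) u∈q in s , σ , there ∘ q⊆ ∘ s⊆
  ...   | no  u∉q = u ∷ q , (step uw wq , ¬Any⇒All¬ q u∉q ∷ uq) , ∷⁺ʳ u q⊆

  prefixTo : ∀ {x v a p} → IsPath adj x v p → a ∈ₗ p → a ≢ v → ∃[ r ] Walk adj x a r × v ∉ₗ r
  prefixTo (here , _)            (here refl) a≢v = ⊥-elim (a≢v refl)
  prefixTo (here , _)            (there ())  _
  prefixTo (step _ _ , _)        (here refl) a≢v = _ , here , λ { (here v≡a) → a≢v (sym v≡a) }
  prefixTo {x} (step xy r , x∉ ∷ uq) (there a∈) a≢v with prefixTo (r , uq) a∈ a≢v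
  ... | s , σ , v∉s = x ∷ s , step xy σ , v∉
    where
    v∉ : _ ∉ₗ x ∷ s
    v∉ (here v≡x) = All¬⇒¬Any x∉ (subst (_∈ₗ _) v≡x (∈-last r))
    v∉ (there v∈) = v∉s v∈

  penultimate : ∀ {z b p} → Walk adj z b p → z ≢ b →
                ∃₂ λ c r → Walk adj z c r × adj c b ≡ true × b ∉ₗ r × r ⊆ p
  penultimate here z≢b = ⊥-elim (z≢b refl)
  penultimate {z} {b} (step {w = w} zw r) z≢b with w ≟ b
  ... | yes refl = z , z ∷ [] , here , zw , (λ { (here b≡z) → z≢b (sym b≡z) }) , ∷⁺ʳ z (λ ())
  ... | no  w≢b  with penultimate r w≢b
  ...   | c , s , σ , cb , b∉s , s⊆ = c , z ∷ s , step zw σ , cb , b∉ , ∷⁺ʳ z s⊆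
    where
    b∉ : b ∉ₗ z ∷ s
    b∉ (here b≡z) = z≢b (sym b≡z)
    b∉ (there b∈) = b∉s b∈

  loop-trivial : ∀ {v p x} → IsPath adj v v p → x ∈ₗ p → x ≡ v
  loop-trivial (here , _)             (here x≡v) = x≡v
  loop-trivial (step _ _ , _)         (here x≡v) = x≡v
  loop-trivial (step _ r , v∉ ∷ _)    (there _)  = ⊥-elim (All¬⇒¬Any v∉ (∈-last r))

  Cut : Subset n → Fin n → Fin n → Set
  Cut B a b = ∀ {x z} → x ∈ B → adj x z ≡ true → z ∉ B → x ≡ a × z ≡ b

  ∁-cut : ∀ {B a b} → Cut B a b → Cut (∁ B) b a
  ∁-cut cut x∈∁B xz z∉∁B with cut (x∉∁p⇒x∈p z∉∁B) (trans (adj-sym _ _) xz) (x∈∁p⇒x∉p x∈∁B)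
  ... | z≡a , x≡b = x≡b , z≡a

  cut-avoided : ∀ {B a b x z p} → Cut B a b → Walk adj x z p → x ∈ B → b ∉ₗ p → z ∈ B
  cut-avoided cut here x∈B b∉ = x∈B
  cut-avoided {B} cut (step {w = y} xy r) x∈B b∉ with y ∈? B
  ... | yes y∈B = cut-avoided cut r y∈B (b∉ ∘ there)
  ... | no  y∉B = ⊥-elim (b∉ (there (subst (_∈ₗ _) (proj₂ (cut x∈B xy y∉B)) (∈-head r))))

  -- leaving B at a and coming back would need to pass a a second time
  cut-pathConvex : ∀ {B a b x z p} → Cut B a b → x ∈ B → z ∈ B → IsPath adj x z p → All (_∈ B) p
  cut-pathConvex cut x∈B z∈B (here , _) = x∈B All.∷ All.[]
  cut-pathConvex {B} cut x∈B z∈B (step {w = y} xy r , x∉ ∷ uq) with y ∈? B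
  ... | yes y∈B = x∈B All.∷ cut-pathConvex cut y∈B z∈B (r , uq)
  ... | no  y∉B with cut x∈B xy y∉B
  ...   | refl , _ = ⊥-elim (x∈∁p⇒x∉p (cut-avoided (∁-cut cut) r (x∉p⇒x∈∁p y∉B) (All¬⇒¬Any x∉)) z∈B)

module Tree {n : ℕ} (t : SignedTree n) where

  open Graph (adj t) (symmetric t) public
  open import Data.List.Membership.DecPropositional (_≟_ {n}) using () renaming (_∈?_ to _∈ₗ?_)

  adj⇒≢ : ∀ {a b} → adj t a b ≡ true → a ≢ b
  adj⇒≢ {a} ab refl with trans (sym ab) (loopless t a)
  ... | ()

  walk-between-neighbours-visits : ∀ {a b c p} → adj t a b ≡ true → adj t c b ≡ true → a ≢ c →
                                   Walk (adj t) a c p → ¬ b ∉ₗ p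
  walk-between-neighbours-visits {a} {b} ab cb a≢c σ b∉ with toPath σ
  ... | _ , (here , _) , _ = a≢c refl
  ... | q , (step ay r , uq) , q⊆ =
    acyclic t _ _ (_ ∷ q) (step (trans (symmetric t b a) ab) (step ay r) , ¬Any⇒All¬ q (b∉ ∘ q⊆) ∷ uq)
            (s≤s (s≤s (1≤length r))) cb

  path : ∀ x y → ∃[ p ] IsPath (adj t) x y p
  path x y = let p , π , _ = toPath (proj₂ (connected t x y)) in p , π

  route : Fin n → Fin n → List (Fin n)
  route x y = proj₁ (path x y)

  side : Fin n → Fin n → Subset n
  side a b = decSubset (λ x → a ∈ₗ? route x b)

  ∈-side : ∀ {a b x} → x ∈ side a b ⇔ a ∈ₗ route x b
  ∈-side {a} {b} = ∈-decSubset (λ x → a ∈ₗ? route x b)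

  walk-from-side : ∀ {a b x} → a ≢ b → x ∈ side a b → ∃[ r ] Walk (adj t) a x r × b ∉ₗ r
  walk-from-side {b = b} {x} a≢b x∈ with prefixTo (proj₂ (path x b)) (to ∈-side x∈) a≢b
  ... | r , ρ , b∉r = let r′ , ρ′ , r′⊆ = reverse ρ in r′ , ρ′ , b∉r ∘ r′⊆

  -- a second edge leaving the side of a would close a walk between two neighbours of b avoiding b
  side-cut : ∀ {a b} → adj t a b ≡ true → Cut (side a b) a b
  side-cut {a} {b} ab {x} {z} x∈ xz z∉ with walk-from-side (adj⇒≢ ab) x∈
  ... | r , a⇝x , b∉r with z ≟ b | x ≟ a
  ...   | yes refl | yes refl = refl , refl
  ...   | yes refl | no x≢a   = ⊥-elim (walk-between-neighbours-visits ab xz (≢-sym x≢a) a⇝x b∉r)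
  ...   | no z≢b   | _        with penultimate (proj₁ (proj₂ (path z b))) z≢b
  ...     | c , s , σ , cb , b∉s , s⊆ =
    ⊥-elim (walk-between-neighbours-visits ab cb a≢c (join a⇝x xz σ) b∉)
    where
    a≢c : a ≢ c
    a≢c refl = z∉ (from ∈-side (s⊆ (∈-last σ)))
    b∉ : b ∉ₗ r ++ s
    b∉ b∈ with ∈-++⁻ r b∈
    ... | inj₁ b∈r = b∉r b∈r
    ... | inj₂ b∈s = b∉s b∈s

  separating-cut : ∀ {u v w} → adj t u v ≡ true → w ≢ u → w ≢ v →
                   ∃[ B ] (∃₂ λ a b → Cut B a b) × u ∈ B × v ∈ B × w ∉ B
  separating-cut {u} {v} {w} uv w≢u w≢v with path w u
  ... | _ , here , _ = ⊥-elim (w≢u refl)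
  ... | _ , step {w = y} wy r , w∉ ∷ _ = side y w , (y , w , cut) , u∈ , v∈ , w∉side
    where
    cut : Cut (side y w) y w
    cut = side-cut (trans (symmetric t y w) wy)
    u∈ : u ∈ side y w
    u∈ = cut-avoided cut r (from ∈-side (∈-head (proj₁ (proj₂ (path y w))))) (All¬⇒¬Any w∉)
    v∈ : v ∈ side y w
    v∈ with v ∈? side y w
    ... | yes v∈ = v∈
    ... | no  v∉ = ⊥-elim (w≢v (sym (proj₂ (cut u∈ uv v∉))))
    w∉side : w ∉ side y w
    w∉side w∈ = adj⇒≢ wy (sym (loop-trivial (proj₂ (path w w)) (to ∈-side w∈)))

  two-neighbours : ∀ {v} → ¬ IsLeaf t v → ∃₂ λ u w → adj t u v ≡ true × adj t v w ≡ true × u ≢ w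
  two-neighbours {v} nonleaf with two-distinct (filter⁺ (T? ∘ adj t v) (allFin⁺ n)) nonleaf
  ... | u , w , u∈ , w∈ , u≢w = u , w , trans (symmetric t u v) (neighbour u∈) , neighbour w∈ , u≢w
    where
    neighbour : ∀ {x} → x ∈ₗ filter (T? ∘ adj t v) (allFin n) → adj t v x ≡ true
    neighbour x∈ = to T-≡ (proj₂ (∈-filter⁻ (T? ∘ adj t v) {xs = allFin n} x∈))

  PathConvex : Subset n → Set
  PathConvex B = ∀ {u v p} → u ∈ B → v ∈ B → IsPath (adj t) u v p → All (_∈ B) p

  pathConvex⇒convex : ∀ {B} → PathConvex B → ∀ s → Convex s t B
  pathConvex⇒convex convex s u v p u∈ v∈ π w w∈p _ = All.lookup (convex u∈ v∈ π) w∈p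

  cut⇒isBuildingBlock : ∀ {B a b} → Cut B a b → IsBuildingBlock t B
  cut⇒isBuildingBlock cut = pathConvex⇒convex (cut-pathConvex cut) neg
                          , pathConvex⇒convex (cut-pathConvex (∁-cut cut)) pos

  ⁅⁆-pathConvex : ∀ {v} → PathConvex ⁅ v ⁆
  ⁅⁆-pathConvex {v} u∈ w∈ π with x∈⁅y⁆⇒x≡y v u∈ | x∈⁅y⁆⇒x≡y v w∈
  ... | refl | refl = All.tabulate (λ x∈p → subst (_∈ ⁅ v ⁆) (sym (loop-trivial π x∈p)) (x∈⁅x⁆ v))

  ∁⁅⁆-convex : ∀ {v s} → sign t v ≢ s → Convex s t (∁ ⁅ v ⁆)
  ∁⁅⁆-convex {v} sv≢s _ _ _ _ _ _ w _ sw≡s =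
    x∉p⇒x∈∁p (λ w∈ → sv≢s (subst (λ x → sign t x ≡ _) (x∈⁅y⁆⇒x≡y v w∈) sw≡s))

  neg⇒⁅⁆-isBuildingBlock : ∀ {v} → sign t v ≡ neg → IsBuildingBlock t ⁅ v ⁆
  neg⇒⁅⁆-isBuildingBlock sv = pathConvex⇒convex ⁅⁆-pathConvex neg
                            , ∁⁅⁆-convex (λ sv≡pos → neg≢pos (trans (sym sv) sv≡pos))

  pos⇒∁⁅⁆-isBuildingBlock : ∀ {v} → sign t v ≡ pos → IsBuildingBlock t (∁ ⁅ v ⁆)
  pos⇒∁⁅⁆-isBuildingBlock {v} sv = ∁⁅⁆-convex (λ sv≡neg → neg≢pos (trans (sym sv≡neg) sv))
    , subst (Convex pos t) (sym (∁-involutive ⁅ v ⁆)) (pathConvex⇒convex ⁅⁆-pathConvex pos)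

  complementary-blocks⇒convex : ∀ {B} → IsBuildingBlock t B → IsBuildingBlock t (∁ B) → ∀ s → Convex s t B
  complementary-blocks⇒convex     block _      neg = proj₁ block
  complementary-blocks⇒convex {B} _     block∁ pos = subst (Convex pos t) (∁-involutive B) (proj₂ block∁)

  middle-¬convex : ∀ {u v w s} → IsPath (adj t) u w (u ∷ v ∷ w ∷ []) → sign t v ≡ s → ¬ Convex s t (∁ ⁅ v ⁆)
  middle-¬convex {v = v} π@(_ , (u≢v All.∷ _) ∷ (v≢w All.∷ _) ∷ _) sv convex =
    x∈∁p⇒x∉p (convex _ _ _ (outside u≢v) (outside (≢-sym v≢w)) π v (there (here refl)) sv) (x∈⁅x⁆ v)
    where
    outside : ∀ {x} → x ≢ v → x ∈ ∁ ⁅ v ⁆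
    outside x≢v = x∉p⇒x∈∁p (x≢y⇒x∉⁅y⁆ x≢v)

SameBuildingBlocks : ∀ {n} → SignedTree n → SignedTree n → Set
SameBuildingBlocks {n} t t′ = ∀ (B : Subset n) → IsBuildingBlock t B ⇔ IsBuildingBlock t′ B

adj-preserved : ∀ {n} (t t′ : SignedTree n) → SameBuildingBlocks t t′ →
                ∀ {u v} → adj t u v ≡ true → adj t′ u v ≡ true
adj-preserved t t′ same {u} {v} uv with Tree.path t′ u v
... | _ , here , _          = ⊥-elim (Tree.adj⇒≢ t uv refl)
... | _ , step uv′ here , _ = uv′
... | p , π@(step {w = w} _ (step _ r) , (u≢w All.∷ _) ∷ w∉ ∷ _)
  with Tree.separating-cut t uv (≢-sym u≢w) (All.lookup w∉ (Tree.∈-last t′ r))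
...   | B , (_ , _ , cut) , u∈ , v∈ , w∉B =
  ⊥-elim (w∉B (convex (sign t′ w) u v p u∈ v∈ π w (there (here refl)) refl))
  where
  convex : ∀ s → Convex s t′ B
  convex = Tree.complementary-blocks⇒convex t′
             (to (same B) (Tree.cut⇒isBuildingBlock t cut))
             (to (same (∁ B)) (Tree.cut⇒isBuildingBlock t (Tree.∁-cut t cut)))

adj-≡ : ∀ {n} (t t′ : SignedTree n) → SameBuildingBlocks t t′ → ∀ u v → adj t u v ≡ adj t′ u v
adj-≡ t t′ same u v = ⇔→≡ (mk⇔ (adj-preserved t t′ same) (adj-preserved t′ t (λ B → ⇔.sym (same B))))

nonleaf-¬convex : ∀ {n} (t t′ : SignedTree n) → SameBuildingBlocks t t′ →
                  ∀ {v s} → ¬ IsLeaf t v → sign t′ v ≡ s → ¬ Convex s t′ (∁ ⁅ v ⁆)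
nonleaf-¬convex t t′ same {v} nonleaf with Tree.two-neighbours t nonleaf
... | u , w , uv , vw , u≢w = Tree.middle-¬convex t′ (walk′ , unique)
  where
  walk′ : Walk (adj t′) u w (u ∷ v ∷ w ∷ [])
  walk′ = walk-resp-adj (adj-≡ t t′ same) (step uv (step vw here))
  unique : Unique (u ∷ v ∷ w ∷ [])
  unique = (Tree.adj⇒≢ t uv All.∷ u≢w All.∷ All.[]) ∷ (Tree.adj⇒≢ t vw All.∷ All.[]) ∷ All.[] ∷ []

sign-preserved : ∀ {n} (t t′ : SignedTree n) → SameBuildingBlocks t t′ →
                 ∀ v → ¬ IsLeaf t v → sign t v ≡ sign t′ v
sign-preserved t t′ same v nonleaf with sign t v in sv | sign t′ v in sv′
... | neg | neg = refl
... | pos | pos = refl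
... | neg | pos = ⊥-elim (nonleaf-¬convex t t′ same nonleaf sv′
                           (proj₂ (to (same ⁅ v ⁆) (Tree.neg⇒⁅⁆-isBuildingBlock t sv))))
... | pos | neg = ⊥-elim (nonleaf-¬convex t t′ same nonleaf sv′
                           (proj₁ (to (same (∁ ⁅ v ⁆)) (Tree.pos⇒∁⁅⁆-isBuildingBlock t sv))))

corollary66 : {n : ℕ} (t t′ : SignedTree n) →
    (∀ (B : Subset n) → IsBuildingBlock t B ⇔ IsBuildingBlock t′ B) →
    (∀ (u v : Fin n) → adj t u v ≡ adj t′ u v) ×
    (∀ (v : Fin n) → ¬ IsLeaf t v → sign t v ≡ sign t′ v)
corollary66 t t′ same = adj-≡ t t′ same , sign-preserved t t′ same
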